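{- For each $n\ge1$, let $\partial_n$ be the $\mathcal C$-linear derivation of $\mathfrak H$ with \[ \partial_n(\mathbf a)=\frac{(-1)^n}{n}\mathbf a\{\mathbf a(\mathbf b+1)+\hbar\mathbf b\}^{n-1}(\mathbf a+\hbar)\mathbf b,\qquad \partial_n(\mathbf b)=\frac{(-1)^{n-1}}{n}\mathbf a\{(\mathbf b+1)\mathbf a+\hbar\mathbf b\}^{n-1}(\mathbf b+1)\mathbf b. \] Then $\partial_n(\widehat{\mathfrak H^0})\subset\widehat{\mathfrak H^0}$.
   Context: Let $\hbar$ be a formal variable, $\mathcal{C}=\mathbb{Q}[\hbar,\hbar^{ -1}]$, and $\mathfrak{H}=\mathcal{C}\langle \mathbf{a},\mathbf{b}\rangle$ the non-commutative polynomial ring over $\mathcal{C}$. Let $\widehat{\mathbb{N}}=\{\overline{1}\}\sqcup\mathbb{N}$, $\overline1$ a new symbol. Put $e_{\overline{1}}=\mathbf{a}\mathbf{b}$ and $e_k=\mathbf{a}^{k-1}(\mathbf{a}+\hbar)\mathbf{b}$ for $k\ge 1$. An index is a tuple $\mathbf k=(k_1,\dots,k_r)$, $r\ge0$, of elements of $\widehat{\mathbb N}$, and $e_{\mathbf k}=e_{k_1}\cdots e_{k_r}$ ($e_\emptyset=1$). $\widehat{\mathfrak H^0}$ denotes the $\mathcal C$-submodule of $\mathfrak H$ spanned by $e_{\mathbf k}$ for all indices $\mathbf k$ that are empty or satisfy $k_1\neq1$ (it is a $\mathcal C$-subalgebra). -}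

module Defs where

open import Data.Nat as ℕ using (ℕ; zero; suc; NonZero)
open import Data.Integer as ℤ using (ℤ)
open import Data.Rational as ℚ using (ℚ)
open import Data.List using (List; []; _∷_; _++_; map; concatMap; foldr)
import Data.List.Properties as LP
open import Data.Product using (_×_; _,_; Σ; ∃)
open import Data.Bool using (if_then_else_; _∧_)
open import Relation.Nullary using (¬_; yes; no; does)
open import Relation.Binary.PropositionalEquality using (_≡_; refl)
open import Relation.Binary.Definitions using (DecidableEquality)
open import Data.Unit using (⊤)

-- An element of 𝔥 is represented by a finite formal sum of terms
-- q · ħ^e · w  (q ∈ ℚ, e ∈ ℤ, w a word in the letters a, b).
-- Two representations denote the same element iff all their
-- coefficients agree (relation _≈_ below).

data Letter : Set where
  𝐚 𝐛 : Letter

_≟L_ : DecidableEquality Letter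
𝐚 ≟L 𝐚 = yes refl
𝐚 ≟L 𝐛 = no λ ()
𝐛 ≟L 𝐚 = no λ ()
𝐛 ≟L 𝐛 = yes refl

Word : Set
Word = List Letter

_≟W_ : DecidableEquality Word
_≟W_ = LP.≡-dec _≟L_

Term : Set
Term = ℚ × ℤ × Word

𝔥 : Set
𝔥 = List Term

coeff : 𝔥 → ℤ → Word → ℚ
coeff [] e w = ℚ.0ℚ
coeff ((q , e′ , w′) ∷ p) e w =
  (if does (e′ ℤ.≟ e) ∧ does (w′ ≟W w) then q else ℚ.0ℚ) ℚ.+ coeff p e w

_≈_ : 𝔥 → 𝔥 → Set
x ≈ y = ∀ e w → coeff x e w ≡ coeff y e w

0𝔥 : 𝔥
0𝔥 = []

1𝔥 : 𝔥
1𝔥 = (ℚ.1ℚ , ℤ.0ℤ , []) ∷ []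

_⊕_ : 𝔥 → 𝔥 → 𝔥
_⊕_ = _++_

_⊗_ : 𝔥 → 𝔥 → 𝔥
x ⊗ y = concatMap (λ { (q , e , w) → map (λ { (q′ , e′ , w′) → (q ℚ.* q′ , e ℤ.+ e′ , w ++ w′) }) y }) x

infixl 6 _⊕_
infixl 7 _⊗_

_^_ : 𝔥 → ℕ → 𝔥
x ^ zero = 1𝔥
x ^ suc n = x ⊗ x ^ n

_·_ : ℚ → 𝔥 → 𝔥
q · x = ((q , ℤ.0ℤ , []) ∷ []) ⊗ x

a b ħ : 𝔥
a = (ℚ.1ℚ , ℤ.0ℤ , 𝐚 ∷ []) ∷ []
b = (ℚ.1ℚ , ℤ.0ℤ , 𝐛 ∷ []) ∷ []
ħ = (ℚ.1ℚ , ℤ.1ℤ , []) ∷ []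

-- 𝒞 = ℚ[ħ, ħ⁻¹], as finite sums of q ħ^e
𝒞 : Set
𝒞 = List (ℚ × ℤ)

ι : 𝒞 → 𝔥
ι = map (λ { (q , e) → (q , e , []) })

-- ℕ̂ = {1̄} ⊔ ℕ ; `pos m` stands for the natural number k = m + 1 ≥ 1
data ℕ̂ : Set where
  1̄   : ℕ̂
  pos : ℕ → ℕ̂

e₁ : ℕ̂ → 𝔥
e₁ 1̄ = a ⊗ b
e₁ (pos m) = a ^ m ⊗ (a ⊕ ħ) ⊗ b        -- a^{k-1}(a+ħ)b with k = m+1

Index : Set
Index = List ℕ̂

eIdx : Index → 𝔥
eIdx [] = 1𝔥
eIdx (k ∷ ks) = e₁ k ⊗ eIdx ks

Admissible : Index → Set
Admissible [] = ⊤
Admissible (k ∷ ks) = ¬ (k ≡ pos 0)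

AdmComb : Set
AdmComb = List (𝒞 × Σ Index Admissible)

evalComb : AdmComb → 𝔥
evalComb = foldr (λ { (c , (k , _)) acc → ι c ⊗ eIdx k ⊕ acc }) 0𝔥

_∈𝔥⁰ : 𝔥 → Set
x ∈𝔥⁰ = ∃ λ (c : AdmComb) → evalComb c ≈ x

sgn : ℕ → ℤ
sgn zero = ℤ.1ℤ
sgn (suc n) = ℤ.- sgn n

∂a : (n : ℕ) → .{{NonZero n}} → 𝔥
∂a n = (sgn n ℚ./ n) · (a ⊗ (a ⊗ (b ⊕ 1𝔥) ⊕ ħ ⊗ b) ^ (n ℕ.∸ 1) ⊗ (a ⊕ ħ) ⊗ b)

∂b : (n : ℕ) → .{{NonZero n}} → 𝔥
∂b n = (sgn (n ℕ.∸ 1) ℚ./ n) · (a ⊗ ((b ⊕ 1𝔥) ⊗ a ⊕ ħ ⊗ b) ^ (n ℕ.∸ 1) ⊗ (b ⊕ 1𝔥) ⊗ b)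

module _ (n : ℕ) .{{_ : NonZero n}} where
  ∂gen : Letter → 𝔥
  ∂gen 𝐚 = ∂a n
  ∂gen 𝐛 = ∂b n

  word : Word → 𝔥
  word w = (ℚ.1ℚ , ℤ.0ℤ , w) ∷ []

  ∂word : Word → 𝔥
  ∂word [] = 0𝔥
  ∂word (l ∷ w) = ∂gen l ⊗ word w ⊕ word (l ∷ []) ⊗ ∂word w

  ∂ : 𝔥 → 𝔥
  ∂ = concatMap (λ { (q , e , w) → ((q , e , []) ∷ []) ⊗ ∂word w })

{-# OPTIONS --safe #-}
module Submission where

-- \hat{𝔥⁰} is the 𝒞-span of 1 and the words a…b: each e_𝐤 with k₁ ≠ 1 is a combination of words a…b,
-- and conversely a word a…b is built from the right using  ħb = e_1 − e_1̄,  a e_k = e_{k+1}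
-- (k ∈ ℕ)  and  a e_1̄ = e_2 − ħ e_1̄,  the final letter a leaving a first index ≠ 1.
-- Since ∂ₙ(a) and ∂ₙ(b) are combinations of words a…b, the Leibniz rule makes ∂ₙ vanish on 𝒞
-- and map every word a…b to a combination of words a…b.

open import Defs
open import Data.Nat as ℕ using (ℕ; zero; suc; NonZero)
open import Data.Integer as ℤ using (ℤ)
import Data.Integer.Properties as ℤP
open import Data.Rational as ℚ using (ℚ; 0ℚ; 1ℚ)
import Data.Rational.Properties as ℚP
open import Data.Rational.Solver using (module +-*-Solver)
open +-*-Solver using (solve; _:+_; _:*_; _:=_; con)
open import Algebra.Bundles using (CommutativeMonoid)
open import Algebra.Properties.CommutativeSemigroup
  (CommutativeMonoid.commutativeSemigroup ℚP.+-0-commutativeMonoid) using (interchange)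
open import Data.List using (List; []; _∷_; _++_; map; deduplicate)
import Data.List.Properties as LP
open import Data.List.Relation.Unary.All as All using (All; []; _∷_)
open import Data.List.Relation.Unary.All.Properties using (++⁺; map⁺)
open import Data.List.Relation.Unary.Any using (here; there)
open import Data.List.Relation.Unary.AllPairs using (_∷_)
open import Data.List.Relation.Unary.Unique.Propositional using (Unique)
open import Data.List.Relation.Unary.Unique.DecPropositional.Properties using (deduplicate-!)
open import Data.List.Membership.Propositional using (_∈_)
open import Data.List.Membership.Propositional.Properties
  using (∈-map⁺; ∈-++⁺ˡ; ∈-++⁺ʳ; ∈-deduplicate⁺)
import Data.Product.Properties as PP
open import Data.Product using (_×_; _,_; Σ; proj₂)
open import Data.Bool using (Bool; true; false; if_then_else_; _∧_)
open import Data.Sum using (_⊎_; inj₁; inj₂)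
open import Data.Unit using (⊤; tt)
open import Data.Empty using (⊥-elim)
open import Relation.Nullary using (¬_; yes; no; does)
open import Relation.Binary.Definitions using (DecidableEquality)
open import Relation.Binary.Bundles using (Setoid)
open import Relation.Binary.PropositionalEquality
  using (_≡_; refl; sym; trans; cong; cong₂; subst; module ≡-Reasoning)
import Relation.Binary.Reasoning.Setoid as SetoidReasoning

Weight : Set
Weight = ℤ → Word → ℚ

weigh : Weight → 𝔥 → ℚ
weigh F [] = 0ℚ
weigh F ((q , e , w) ∷ x) = q ℚ.* F e w ℚ.+ weigh F x

shift : ℤ → Word → Weight → Weight
shift e w F e′ w′ = F (e ℤ.+ e′) (w ++ w′)

monomial : ℚ → ℤ → Word → 𝔥
monomial q e w = (q , e , w) ∷ []

scalar : ℚ → ℤ → 𝔥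
scalar q e = monomial q e []

-- Agreement under all weighings is the same as ≈ (see ≈⇒≋ and ≋⇒≈), but is a congruence
-- for ⊗ by mere rearrangement of sums.
infix 4 _≋_
record _≋_ (x y : 𝔥) : Set where
  constructor mk≋
  field weigh-≡ : ∀ F → weigh F x ≡ weigh F y
open _≋_

weigh-++ : ∀ F x y → weigh F (x ++ y) ≡ weigh F x ℚ.+ weigh F y
weigh-++ F [] y = sym (ℚP.+-identityˡ _)
weigh-++ F ((q , e , w) ∷ x) y =
  trans (cong (q ℚ.* F e w ℚ.+_) (weigh-++ F x y)) (sym (ℚP.+-assoc (q ℚ.* F e w) (weigh F x) (weigh F y)))

weigh-cong : ∀ {F G} → (∀ e w → F e w ≡ G e w) → ∀ x → weigh F x ≡ weigh G x
weigh-cong F≗G [] = refl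
weigh-cong F≗G ((q , e , w) ∷ x) = cong₂ (λ u v → q ℚ.* u ℚ.+ v) (F≗G e w) (weigh-cong F≗G x)

weigh-+ : ∀ F G x → weigh (λ e w → F e w ℚ.+ G e w) x ≡ weigh F x ℚ.+ weigh G x
weigh-+ F G [] = sym (ℚP.+-identityˡ 0ℚ)
weigh-+ F G ((q , e , w) ∷ x) =
  trans (cong₂ ℚ._+_ (ℚP.*-distribˡ-+ q (F e w) (G e w)) (weigh-+ F G x))
        (interchange (q ℚ.* F e w) (q ℚ.* G e w) (weigh F x) (weigh G x))

weigh-0 : ∀ x → weigh (λ _ _ → 0ℚ) x ≡ 0ℚ
weigh-0 [] = refl
weigh-0 ((q , e , w) ∷ x) = trans (cong₂ ℚ._+_ (ℚP.*-zeroʳ q) (weigh-0 x)) (ℚP.+-identityˡ 0ℚ)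

weigh-monomial-⊗ : ∀ F q e w y → weigh F (monomial q e w ⊗ y) ≡ q ℚ.* weigh (shift e w F) y
weigh-monomial-⊗ F q e w [] = sym (ℚP.*-zeroʳ q)
weigh-monomial-⊗ F q e w ((q′ , e′ , w′) ∷ y) =
  trans (cong₂ ℚ._+_ (ℚP.*-assoc q q′ _) (weigh-monomial-⊗ F q e w y))
        (sym (ℚP.*-distribˡ-+ q _ _))

∷-⊗ : ∀ q e w x y → ((q , e , w) ∷ x) ⊗ y ≡ monomial q e w ⊗ y ++ x ⊗ y
∷-⊗ q e w x y = cong (_++ x ⊗ y) (sym (LP.++-identityʳ _))

weigh-⊗ : ∀ F x y → weigh F (x ⊗ y) ≡ weigh (λ e w → weigh (shift e w F) y) x
weigh-⊗ F [] y = refl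
weigh-⊗ F ((q , e , w) ∷ x) y = begin
  weigh F (((q , e , w) ∷ x) ⊗ y)                      ≡⟨ cong (weigh F) (∷-⊗ q e w x y) ⟩
  weigh F (monomial q e w ⊗ y ++ x ⊗ y)                ≡⟨ weigh-++ F (monomial q e w ⊗ y) (x ⊗ y) ⟩
  weigh F (monomial q e w ⊗ y) ℚ.+ weigh F (x ⊗ y)     ≡⟨ cong₂ ℚ._+_ (weigh-monomial-⊗ F q e w y) (weigh-⊗ F x y) ⟩
  q ℚ.* weigh (shift e w F) y ℚ.+ weigh _ x            ∎
  where open ≡-Reasoning

≋-refl : ∀ {x} → x ≋ x
≋-refl = mk≋ λ F → refl

≋-sym : ∀ {x y} → x ≋ y → y ≋ x
≋-sym x≋y = mk≋ λ F → sym (weigh-≡ x≋y F)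

≋-trans : ∀ {x y z} → x ≋ y → y ≋ z → x ≋ z
≋-trans x≋y y≋z = mk≋ λ F → trans (weigh-≡ x≋y F) (weigh-≡ y≋z F)

≡⇒≋ : ∀ {x y} → x ≡ y → x ≋ y
≡⇒≋ refl = ≋-refl

≋-setoid : Setoid _ _
≋-setoid = record
  { Carrier = 𝔥 ; _≈_ = _≋_
  ; isEquivalence = record { refl = ≋-refl ; sym = ≋-sym ; trans = ≋-trans } }

module ≋-Reasoning = SetoidReasoning ≋-setoid

++-cong : ∀ {x x′ y y′} → x ≋ x′ → y ≋ y′ → x ++ y ≋ x′ ++ y′
++-cong {x} {x′} {y} {y′} x≋x′ y≋y′ = mk≋ λ F →
  trans (weigh-++ F x y)
        (trans (cong₂ ℚ._+_ (weigh-≡ x≋x′ F) (weigh-≡ y≋y′ F)) (sym (weigh-++ F x′ y′)))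

⊗-congˡ : ∀ {x x′} y → x ≋ x′ → x ⊗ y ≋ x′ ⊗ y
⊗-congˡ {x} {x′} y x≋x′ = mk≋ λ F →
  trans (weigh-⊗ F x y) (trans (weigh-≡ x≋x′ _) (sym (weigh-⊗ F x′ y)))

⊗-congʳ : ∀ x {y y′} → y ≋ y′ → x ⊗ y ≋ x ⊗ y′
⊗-congʳ x {y} {y′} y≋y′ = mk≋ λ F →
  trans (weigh-⊗ F x y)
        (trans (weigh-cong (λ e w → weigh-≡ y≋y′ (shift e w F)) x) (sym (weigh-⊗ F x y′)))

⊗-assoc : ∀ x y z → (x ⊗ y) ⊗ z ≋ x ⊗ (y ⊗ z)
⊗-assoc x y z = mk≋ λ F → begin
  weigh F ((x ⊗ y) ⊗ z)
    ≡⟨ trans (weigh-⊗ F (x ⊗ y) z) (weigh-⊗ _ x y) ⟩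
  weigh (λ e w → weigh (λ e′ w′ → weigh (shift (e ℤ.+ e′) (w ++ w′) F) z) y) x
    ≡⟨ weigh-cong (λ e w → weigh-cong (λ e′ w′ → weigh-cong (λ e″ w″ →
         cong₂ F (ℤP.+-assoc e e′ e″) (LP.++-assoc w w′ w″)) z) y) x ⟩
  weigh (λ e w → weigh (λ e′ w′ → weigh (shift e′ w′ (shift e w F)) z) y) x
    ≡⟨ weigh-cong (λ e w → weigh-⊗ (shift e w F) y z) x ⟨
  weigh (λ e w → weigh (shift e w F) (y ⊗ z)) x
    ≡⟨ weigh-⊗ F x (y ⊗ z) ⟨
  weigh F (x ⊗ (y ⊗ z))
    ∎
  where open ≡-Reasoning

⊗-distribʳ : ∀ x x′ y → (x ++ x′) ⊗ y ≋ x ⊗ y ++ x′ ⊗ y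
⊗-distribʳ x x′ y = mk≋ λ F → begin
  weigh F ((x ++ x′) ⊗ y)                       ≡⟨ trans (weigh-⊗ F (x ++ x′) y) (weigh-++ _ x x′) ⟩
  weigh _ x ℚ.+ weigh _ x′                      ≡⟨ cong₂ ℚ._+_ (weigh-⊗ F x y) (weigh-⊗ F x′ y) ⟨
  weigh F (x ⊗ y) ℚ.+ weigh F (x′ ⊗ y)          ≡⟨ weigh-++ F (x ⊗ y) (x′ ⊗ y) ⟨
  weigh F (x ⊗ y ++ x′ ⊗ y)                     ∎
  where open ≡-Reasoning

⊗-distribˡ : ∀ x y y′ → x ⊗ (y ++ y′) ≋ x ⊗ y ++ x ⊗ y′
⊗-distribˡ x y y′ = mk≋ λ F → begin
  weigh F (x ⊗ (y ++ y′))
    ≡⟨ trans (weigh-⊗ F x (y ++ y′)) (weigh-cong (λ e w → weigh-++ (shift e w F) y y′) x) ⟩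
  weigh (λ e w → weigh (shift e w F) y ℚ.+ weigh (shift e w F) y′) x
    ≡⟨ weigh-+ _ _ x ⟩
  weigh _ x ℚ.+ weigh _ x
    ≡⟨ cong₂ ℚ._+_ (weigh-⊗ F x y) (weigh-⊗ F x y′) ⟨
  weigh F (x ⊗ y) ℚ.+ weigh F (x ⊗ y′)
    ≡⟨ weigh-++ F (x ⊗ y) (x ⊗ y′) ⟨
  weigh F (x ⊗ y ++ x ⊗ y′)
    ∎
  where open ≡-Reasoning

⊗-zeroʳ : ∀ x → x ⊗ [] ≋ []
⊗-zeroʳ x = mk≋ λ F → trans (weigh-⊗ F x []) (weigh-0 x)

⊗-identityˡ : ∀ x → 1𝔥 ⊗ x ≋ x
⊗-identityˡ x = mk≋ λ F →
  trans (weigh-monomial-⊗ F 1ℚ ℤ.0ℤ [] x)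
        (trans (ℚP.*-identityˡ _) (weigh-cong (λ e w → cong (λ e′ → F e′ w) (ℤP.+-identityˡ e)) x))

⊗-identityʳ : ∀ x → x ⊗ 1𝔥 ≋ x
⊗-identityʳ x = mk≋ λ F → trans (weigh-⊗ F x 1𝔥) (weigh-cong (unit F) x)
  where
  unit : ∀ F e w → weigh (shift e w F) 1𝔥 ≡ F e w
  unit F e w = trans (ℚP.+-identityʳ _)
                     (trans (ℚP.*-identityˡ _) (cong₂ F (ℤP.+-identityʳ e) (LP.++-identityʳ w)))

scalar-⊗-comm : ∀ q e p f u → monomial p f u ⊗ scalar q e ≋ scalar q e ⊗ monomial p f u
scalar-⊗-comm q e p f u = mk≋ λ F →
  cong (ℚ._+ 0ℚ) (cong₂ ℚ._*_ (ℚP.*-comm p q) (cong₂ F (ℤP.+-comm f e) (LP.++-identityʳ u)))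

Key : Set
Key = ℤ × Word

_≟K_ : DecidableEquality Key
_≟K_ = PP.≡-dec ℤ._≟_ _≟W_

key : Term → Key
key (_ , e , w) = e , w

matches : ℤ → Word → ℤ → Word → Bool
matches e′ w′ e w = does (e′ ℤ.≟ e) ∧ does (w′ ≟W w)

matches-refl : ∀ e w → matches e w e w ≡ true
matches-refl e w with e ℤ.≟ e | w ≟W w
... | yes _  | yes _  = refl
... | yes _  | no w≢w = ⊥-elim (w≢w refl)
... | no e≢e | _      = ⊥-elim (e≢e refl)

matches-≢ : ∀ {e′ w′ e w} → ¬ (e′ , w′) ≡ (e , w) → matches e′ w′ e w ≡ false
matches-≢ {e′} {w′} {e} {w} ≢ with e′ ℤ.≟ e | w′ ≟W w
... | yes refl | yes refl = ⊥-elim (≢ refl)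
... | yes _    | no _     = refl
... | no _     | _        = refl

when : Bool → ℚ → ℚ
when c q = if c then q else 0ℚ

coeffSum : Weight → List Key → 𝔥 → ℚ
coeffSum F [] x = 0ℚ
coeffSum F ((e , w) ∷ K) x = F e w ℚ.* coeff x e w ℚ.+ coeffSum F K x

termCoeffSum : Weight → ℚ → ℤ → Word → List Key → ℚ
termCoeffSum F q e′ w′ [] = 0ℚ
termCoeffSum F q e′ w′ ((e , w) ∷ K) = F e w ℚ.* when (matches e′ w′ e w) q ℚ.+ termCoeffSum F q e′ w′ K

coeffSum-∷ : ∀ F K q e w x → coeffSum F K ((q , e , w) ∷ x) ≡ termCoeffSum F q e w K ℚ.+ coeffSum F K x
coeffSum-∷ F [] q e′ w′ x = sym (ℚP.+-identityˡ 0ℚ)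
coeffSum-∷ F ((e , w) ∷ K) q e′ w′ x =
  trans (cong₂ ℚ._+_ (ℚP.*-distribˡ-+ (F e w) _ (coeff x e w)) (coeffSum-∷ F K q e′ w′ x))
        (interchange (F e w ℚ.* when (matches e′ w′ e w) q) _ _ (coeffSum F K x))

coeffSum-[] : ∀ F K → coeffSum F K [] ≡ 0ℚ
coeffSum-[] F [] = refl
coeffSum-[] F ((e , w) ∷ K) = trans (cong₂ ℚ._+_ (ℚP.*-zeroʳ (F e w)) (coeffSum-[] F K)) (ℚP.+-identityˡ 0ℚ)

termCoeffSum-∉ : ∀ F q e′ w′ K → All (λ k → ¬ (e′ , w′) ≡ k) K → termCoeffSum F q e′ w′ K ≡ 0ℚ
termCoeffSum-∉ F q e′ w′ [] [] = refl
termCoeffSum-∉ F q e′ w′ ((e , w) ∷ K) (≢ ∷ ∉K) rewrite matches-≢ ≢ =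
  trans (cong₂ ℚ._+_ (ℚP.*-zeroʳ (F e w)) (termCoeffSum-∉ F q e′ w′ K ∉K)) (ℚP.+-identityˡ 0ℚ)

termCoeffSum-∈ : ∀ F q e′ w′ K → Unique K → (e′ , w′) ∈ K → termCoeffSum F q e′ w′ K ≡ q ℚ.* F e′ w′
termCoeffSum-∈ F q e′ w′ ((e , w) ∷ K) (∉K ∷ _) (here refl) rewrite matches-refl e w =
  trans (cong (F e w ℚ.* q ℚ.+_) (termCoeffSum-∉ F q e w K ∉K))
        (trans (ℚP.+-identityʳ _) (ℚP.*-comm (F e w) q))
termCoeffSum-∈ F q e′ w′ ((e , w) ∷ K) (≢ ∷ unique) (there ∈K)
  rewrite matches-≢ {e′} {w′} {e} {w} (λ eq → All.lookup ≢ ∈K (sym eq)) =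
  trans (cong₂ ℚ._+_ (ℚP.*-zeroʳ (F e w)) (termCoeffSum-∈ F q e′ w′ K unique ∈K)) (ℚP.+-identityˡ _)

weigh-coeffSum : ∀ F K → Unique K → ∀ x → All (λ t → key t ∈ K) x → weigh F x ≡ coeffSum F K x
weigh-coeffSum F K unique [] [] = sym (coeffSum-[] F K)
weigh-coeffSum F K unique ((q , e , w) ∷ x) (∈K ∷ ⊆K) =
  trans (cong₂ ℚ._+_ (sym (termCoeffSum-∈ F q e w K unique ∈K)) (weigh-coeffSum F K unique x ⊆K))
        (sym (coeffSum-∷ F K q e w x))

coeffSum-≈ : ∀ F K {x y} → x ≈ y → coeffSum F K x ≡ coeffSum F K y
coeffSum-≈ F [] x≈y = refl
coeffSum-≈ F ((e , w) ∷ K) x≈y = cong₂ (λ u v → F e w ℚ.* u ℚ.+ v) (x≈y e w) (coeffSum-≈ F K x≈y)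

-- Weighing only sees the coefficients at the finitely many keys occurring in x and y.
≈⇒≋ : ∀ {x y} → x ≈ y → x ≋ y
≈⇒≋ {x} {y} x≈y = mk≋ λ F →
  trans (weigh-coeffSum F K unique x x⊆K)
        (trans (coeffSum-≈ F K x≈y) (sym (weigh-coeffSum F K unique y y⊆K)))
  where
  keys : List Key
  keys = map key x ++ map key y
  K : List Key
  K = deduplicate _≟K_ keys
  unique : Unique K
  unique = deduplicate-! _≟K_ keys
  x⊆K : All (λ t → key t ∈ K) x
  x⊆K = All.tabulate λ t∈x → ∈-deduplicate⁺ _≟K_ (∈-++⁺ˡ (∈-map⁺ key t∈x))
  y⊆K : All (λ t → key t ∈ K) y
  y⊆K = All.tabulate λ t∈y → ∈-deduplicate⁺ _≟K_ (∈-++⁺ʳ (map key x) (∈-map⁺ key t∈y))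

indicator : ℤ → Word → Weight
indicator e w e′ w′ = when (matches e′ w′ e w) 1ℚ

coeff-weigh : ∀ x e w → coeff x e w ≡ weigh (indicator e w) x
coeff-weigh [] e w = refl
coeff-weigh ((q , e′ , w′) ∷ x) e w = cong₂ ℚ._+_ (when-scale (matches e′ w′ e w)) (coeff-weigh x e w)
  where
  when-scale : ∀ c → when c q ≡ q ℚ.* when c 1ℚ
  when-scale true = sym (ℚP.*-identityʳ q)
  when-scale false = sym (ℚP.*-zeroʳ q)

≋⇒≈ : ∀ {x y} → x ≋ y → x ≈ y
≋⇒≈ {x} {y} x≋y e w =
  trans (coeff-weigh x e w) (trans (weigh-≡ x≋y (indicator e w)) (sym (coeff-weigh y e w)))

module _ (n : ℕ) .{{_ : NonZero n}} where
  weigh-∂ : ∀ F x → weigh F (∂ n x) ≡ weigh (λ e w → weigh (shift e [] F) (∂word n w)) x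
  weigh-∂ F [] = refl
  weigh-∂ F ((q , e , w) ∷ x) =
    trans (weigh-++ F (scalar q e ⊗ ∂word n w) (∂ n x))
          (cong₂ ℚ._+_ (weigh-monomial-⊗ F q e [] (∂word n w)) (weigh-∂ F x))

  ∂-cong : ∀ {x y} → x ≋ y → ∂ n x ≋ ∂ n y
  ∂-cong {x} {y} x≋y = mk≋ λ F → trans (weigh-∂ F x) (trans (weigh-≡ x≋y _) (sym (weigh-∂ F y)))

wordOf : Term → Word
wordOf (_ , _ , w) = w

AllWords : (Word → Set) → 𝔥 → Set
AllWords P = All (λ t → P (wordOf t))

All-⊗ : ∀ {P Q R : Word → Set} → (∀ {u v} → P u → Q v → R (u ++ v)) →
        ∀ {x y} → AllWords P x → AllWords Q y → AllWords R (x ⊗ y)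
All-⊗ combine {[]} [] Qy = []
All-⊗ {Q = Q} {R} combine {(q , e , u) ∷ x} (Pu ∷ Px) Qy = ++⁺ (prefix Qy) (All-⊗ combine Px Qy)
  where
  prefix : ∀ {y} → AllWords Q y → AllWords R (map (λ { (q′ , e′ , v) → (q ℚ.* q′ , e ℤ.+ e′ , u ++ v) }) y)
  prefix [] = []
  prefix (Qv ∷ Qy) = combine Pu Qv ∷ prefix Qy

data StartsWithA : Word → Set where
  𝐚∷_ : ∀ w → StartsWithA (𝐚 ∷ w)

data EndsWithB : Word → Set where
  [𝐛] : EndsWithB (𝐛 ∷ [])
  _∷_ : ∀ l {w} → EndsWithB w → EndsWithB (l ∷ w)

ABWord : Word → Set
ABWord w = StartsWithA w × EndsWithB w

EmptyOrEndsWithB : Word → Set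
EmptyOrEndsWithB w = w ≡ [] ⊎ EndsWithB w

𝔥⁰Word : Word → Set
𝔥⁰Word w = w ≡ [] ⊎ ABWord w

StartsWithA-++ : ∀ {u} v → StartsWithA u → StartsWithA (u ++ v)
StartsWithA-++ v (𝐚∷ w) = 𝐚∷ (w ++ v)

EndsWithB-++ˡ : ∀ u {v} → EndsWithB v → EndsWithB (u ++ v)
EndsWithB-++ˡ [] ends = ends
EndsWithB-++ˡ (l ∷ u) ends = l ∷ EndsWithB-++ˡ u ends

EndsWithB-++ʳ : ∀ {u v} → EndsWithB u → EmptyOrEndsWithB v → EndsWithB (u ++ v)
EndsWithB-++ʳ {u} endsᵤ (inj₁ refl) = subst EndsWithB (sym (LP.++-identityʳ u)) endsᵤ
EndsWithB-++ʳ {u} endsᵤ (inj₂ endsᵥ) = EndsWithB-++ˡ u endsᵥ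

ABWord-++ʳ : ∀ {u v} → ABWord u → EmptyOrEndsWithB v → ABWord (u ++ v)
ABWord-++ʳ {v = v} (startsᵤ , endsᵤ) endsᵥ = StartsWithA-++ v startsᵤ , EndsWithB-++ʳ endsᵤ endsᵥ

a-StartsWithA : AllWords StartsWithA a
a-StartsWithA = (𝐚∷ []) ∷ []

b-EndsWithB : AllWords EndsWithB b
b-EndsWithB = [𝐛] ∷ []

StartsWithA-⊗ : ∀ {x} y → AllWords StartsWithA x → AllWords StartsWithA (x ⊗ y)
StartsWithA-⊗ y starts = All-⊗ (λ {_} {v} sᵤ _ → StartsWithA-++ v sᵤ) starts (All.universal (λ _ → tt) y)

EndsWithB-⊗ : ∀ x {y} → AllWords EndsWithB y → AllWords EndsWithB (x ⊗ y)
EndsWithB-⊗ x ends = All-⊗ (λ {u} _ eᵥ → EndsWithB-++ˡ u eᵥ) (All.universal (λ _ → tt) x) ends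

ABWord-⊗ : ∀ {x y} → AllWords StartsWithA x → AllWords EndsWithB y → AllWords ABWord (x ⊗ y)
ABWord-⊗ = All-⊗ (λ {u} {v} sᵤ eᵥ → StartsWithA-++ v sᵤ , EndsWithB-++ˡ u eᵥ)

scalar-⊗ : ∀ {P} x {y} → AllWords (_≡ []) x → AllWords P y → AllWords P (x ⊗ y)
scalar-⊗ x = All-⊗ λ { refl Pᵥ → Pᵥ }

framed-ABWord : ∀ q X Y → AllWords ABWord (q · (a ⊗ X ⊗ Y ⊗ b))
framed-ABWord q X Y =
  scalar-⊗ (scalar q ℤ.0ℤ) (refl ∷ []) (ABWord-⊗ (StartsWithA-⊗ Y (StartsWithA-⊗ X a-StartsWithA)) b-EndsWithB)

e₁-EndsWithB : ∀ k → AllWords EndsWithB (e₁ k)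
e₁-EndsWithB 1̄ = EndsWithB-⊗ a b-EndsWithB
e₁-EndsWithB (pos m) = EndsWithB-⊗ (a ^ m ⊗ (a ⊕ ħ)) b-EndsWithB

e₁-ABWord : ∀ k → ¬ k ≡ pos 0 → AllWords ABWord (e₁ k)
e₁-ABWord 1̄ _ = ABWord-⊗ a-StartsWithA b-EndsWithB
e₁-ABWord (pos zero) k≢1 = ⊥-elim (k≢1 refl)
e₁-ABWord (pos (suc m)) _ =
  ABWord-⊗ (StartsWithA-⊗ (a ⊕ ħ) (StartsWithA-⊗ (a ^ m) a-StartsWithA)) b-EndsWithB

eIdx-EmptyOrEndsWithB : ∀ ks → AllWords EmptyOrEndsWithB (eIdx ks)
eIdx-EmptyOrEndsWithB [] = inj₁ refl ∷ []
eIdx-EmptyOrEndsWithB (k ∷ ks) =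
  All-⊗ (λ endsᵤ endsᵥ → inj₂ (EndsWithB-++ʳ endsᵤ endsᵥ)) (e₁-EndsWithB k) (eIdx-EmptyOrEndsWithB ks)

eIdx-𝔥⁰Word : ∀ ks → Admissible ks → AllWords 𝔥⁰Word (eIdx ks)
eIdx-𝔥⁰Word [] _ = inj₁ refl ∷ []
eIdx-𝔥⁰Word (k ∷ ks) k≢1 =
  All-⊗ (λ abᵤ endsᵥ → inj₂ (ABWord-++ʳ abᵤ endsᵥ)) (e₁-ABWord k k≢1) (eIdx-EmptyOrEndsWithB ks)

ι-words : ∀ c → AllWords (_≡ []) (ι c)
ι-words [] = []
ι-words (_ ∷ c) = refl ∷ ι-words c

evalComb-𝔥⁰Word : ∀ c → AllWords 𝔥⁰Word (evalComb c)
evalComb-𝔥⁰Word [] = []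
evalComb-𝔥⁰Word ((c , ks , adm) ∷ cs) =
  ++⁺ (scalar-⊗ (ι c) (ι-words c) (eIdx-𝔥⁰Word ks adm)) (evalComb-𝔥⁰Word cs)

module _ (n : ℕ) .{{_ : NonZero n}} where
  ∂a-ABWord : AllWords ABWord (∂a n)
  ∂a-ABWord = framed-ABWord (sgn n ℚ./ n) ((a ⊗ (b ⊕ 1𝔥) ⊕ ħ ⊗ b) ^ (n ℕ.∸ 1)) (a ⊕ ħ)

  ∂b-ABWord : AllWords ABWord (∂b n)
  ∂b-ABWord = framed-ABWord (sgn (n ℕ.∸ 1) ℚ./ n) (((b ⊕ 1𝔥) ⊗ a ⊕ ħ ⊗ b) ^ (n ℕ.∸ 1)) (b ⊕ 1𝔥)

  ∂word-EndsWithB : ∀ {w} → EndsWithB w → AllWords EndsWithB (∂word n w)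
  ∂word-EndsWithB [𝐛] =
    ++⁺ (All-⊗ (λ abᵤ v≡[] → EndsWithB-++ʳ (proj₂ abᵤ) (inj₁ v≡[])) ∂b-ABWord (refl ∷ [])) []
  ∂word-EndsWithB (l ∷ ends) =
    ++⁺ (EndsWithB-⊗ (∂gen n l) (ends ∷ [])) (EndsWithB-⊗ (word n (l ∷ [])) (∂word-EndsWithB ends))

  ∂word-ABWord : ∀ {w} → ABWord w → AllWords ABWord (∂word n w)
  ∂word-ABWord (𝐚∷ w , _ ∷ ends) =
    ++⁺ (All-⊗ (λ abᵤ endsᵥ → ABWord-++ʳ abᵤ (inj₂ endsᵥ)) ∂a-ABWord (ends ∷ []))
        (ABWord-⊗ a-StartsWithA (∂word-EndsWithB ends))

  ∂-ABWord : ∀ {x} → AllWords 𝔥⁰Word x → AllWords ABWord (∂ n x)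
  ∂-ABWord {[]} [] = []
  ∂-ABWord {_ ∷ _} (inj₁ refl ∷ rest) = ∂-ABWord rest
  ∂-ABWord {(q , e , _) ∷ _} (inj₂ ab ∷ rest) =
    ++⁺ (scalar-⊗ (scalar q e) (refl ∷ []) (∂word-ABWord ab)) (∂-ABWord rest)

Combination : Set
Combination = List (ℚ × ℤ × Index)

⟦_⟧ : Combination → 𝔥
⟦ [] ⟧ = []
⟦ (q , e , ks) ∷ g ⟧ = scalar q e ⊗ eIdx ks ++ ⟦ g ⟧

indexOf : ℚ × ℤ × Index → Index
indexOf (_ , _ , ks) = ks

InSpan : (Index → Set) → 𝔥 → Set
InSpan P x = Σ Combination λ g → All (λ t → P (indexOf t)) g × ⟦ g ⟧ ≋ x

⟦⟧-++ : ∀ g h → ⟦ g ++ h ⟧ ≡ ⟦ g ⟧ ++ ⟦ h ⟧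
⟦⟧-++ [] h = refl
⟦⟧-++ ((q , e , ks) ∷ g) h =
  trans (cong (scalar q e ⊗ eIdx ks ++_) (⟦⟧-++ g h)) (sym (LP.++-assoc (scalar q e ⊗ eIdx ks) ⟦ g ⟧ ⟦ h ⟧))

InSpan-≋ : ∀ {P x y} → InSpan P x → x ≋ y → InSpan P y
InSpan-≋ (g , Pg , g≋x) x≋y = g , Pg , ≋-trans g≋x x≋y

InSpan-mono : ∀ {P Q} → (∀ {ks} → P ks → Q ks) → ∀ {x} → InSpan P x → InSpan Q x
InSpan-mono P⇒Q (g , Pg , g≋x) = g , All.map P⇒Q Pg , g≋x

InSpan-[] : ∀ {P} → InSpan P []
InSpan-[] = [] , [] , ≋-refl

InSpan-1𝔥 : ∀ {P} → P [] → InSpan P 1𝔥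
InSpan-1𝔥 P[] = (1ℚ , ℤ.0ℤ , []) ∷ [] , P[] ∷ [] , ≋-refl

InSpan-++ : ∀ {P x y} → InSpan P x → InSpan P y → InSpan P (x ++ y)
InSpan-++ (g , Pg , g≋x) (h , Ph , h≋y) =
  g ++ h , ++⁺ Pg Ph , ≋-trans (≡⇒≋ (⟦⟧-++ g h)) (++-cong g≋x h≋y)

scale : ℚ → ℤ → Combination → Combination
scale q e = map λ { (q′ , e′ , ks) → (q ℚ.* q′ , e ℤ.+ e′ , ks) }

⟦scale⟧ : ∀ q e g → ⟦ scale q e g ⟧ ≋ scalar q e ⊗ ⟦ g ⟧
⟦scale⟧ q e [] = ≋-refl
⟦scale⟧ q e ((q′ , e′ , ks) ∷ g) = begin
  (scalar q e ⊗ scalar q′ e′) ⊗ eIdx ks ++ ⟦ scale q e g ⟧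
    ≈⟨ ++-cong (⊗-assoc (scalar q e) (scalar q′ e′) (eIdx ks)) (⟦scale⟧ q e g) ⟩
  scalar q e ⊗ (scalar q′ e′ ⊗ eIdx ks) ++ scalar q e ⊗ ⟦ g ⟧
    ≈⟨ ⊗-distribˡ (scalar q e) (scalar q′ e′ ⊗ eIdx ks) ⟦ g ⟧ ⟨
  scalar q e ⊗ ⟦ (q′ , e′ , ks) ∷ g ⟧
    ∎
  where open ≋-Reasoning

InSpan-scalar : ∀ {P x} q e → InSpan P x → InSpan P (scalar q e ⊗ x)
InSpan-scalar q e (g , Pg , g≋x) =
  scale q e g , map⁺ Pg , ≋-trans (⟦scale⟧ q e g) (⊗-congʳ (scalar q e) g≋x)

monomial-⊗-scalar : ∀ p f u q e y → monomial p f u ⊗ (scalar q e ⊗ y) ≋ scalar q e ⊗ (monomial p f u ⊗ y)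
monomial-⊗-scalar p f u q e y = begin
  monomial p f u ⊗ (scalar q e ⊗ y)  ≈⟨ ⊗-assoc (monomial p f u) (scalar q e) y ⟨
  (monomial p f u ⊗ scalar q e) ⊗ y  ≈⟨ ⊗-congˡ y (scalar-⊗-comm q e p f u) ⟩
  (scalar q e ⊗ monomial p f u) ⊗ y  ≈⟨ ⊗-assoc (scalar q e) (monomial p f u) y ⟩
  scalar q e ⊗ (monomial p f u ⊗ y)  ∎
  where open ≋-Reasoning

InSpan-monomial-⊗ : ∀ {P Q} p f u → (∀ {ks} → P ks → InSpan Q (monomial p f u ⊗ eIdx ks)) →
                    ∀ {x} → InSpan P x → InSpan Q (monomial p f u ⊗ x)
InSpan-monomial-⊗ {P} {Q} p f u step (g , Pg , g≋x) = InSpan-≋ (go g Pg) (⊗-congʳ m g≋x)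
  where
  m : 𝔥
  m = monomial p f u
  go : ∀ g → All (λ t → P (indexOf t)) g → InSpan Q (m ⊗ ⟦ g ⟧)
  go [] [] = InSpan-≋ InSpan-[] (≋-sym (⊗-zeroʳ m))
  go ((q , e , ks) ∷ g) (Pks ∷ Pg) = InSpan-≋ (InSpan-++ (InSpan-scalar q e (step Pks)) (go g Pg)) (begin
    scalar q e ⊗ (m ⊗ eIdx ks) ++ m ⊗ ⟦ g ⟧  ≈⟨ ++-cong (monomial-⊗-scalar p f u q e (eIdx ks)) ≋-refl ⟨
    m ⊗ (scalar q e ⊗ eIdx ks) ++ m ⊗ ⟦ g ⟧  ≈⟨ ⊗-distribˡ m (scalar q e ⊗ eIdx ks) ⟦ g ⟧ ⟨
    m ⊗ ⟦ (q , e , ks) ∷ g ⟧                 ∎)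
    where open ≋-Reasoning

_⊙_ : Combination → Index → Combination
g ⊙ ks = map (λ { (q , e , js) → (q , e , js ++ ks) }) g

eIdx-++ : ∀ js ks → eIdx (js ++ ks) ≋ eIdx js ⊗ eIdx ks
eIdx-++ [] ks = ≋-sym (⊗-identityˡ (eIdx ks))
eIdx-++ (j ∷ js) ks = ≋-trans (⊗-congʳ (e₁ j) (eIdx-++ js ks)) (≋-sym (⊗-assoc (e₁ j) (eIdx js) (eIdx ks)))

⟦⊙⟧ : ∀ g ks → ⟦ g ⊙ ks ⟧ ≋ ⟦ g ⟧ ⊗ eIdx ks
⟦⊙⟧ [] ks = ≋-refl
⟦⊙⟧ ((q , e , js) ∷ g) ks = begin
  scalar q e ⊗ eIdx (js ++ ks) ++ ⟦ g ⊙ ks ⟧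
    ≈⟨ ++-cong (⊗-congʳ (scalar q e) (eIdx-++ js ks)) (⟦⊙⟧ g ks) ⟩
  scalar q e ⊗ (eIdx js ⊗ eIdx ks) ++ ⟦ g ⟧ ⊗ eIdx ks
    ≈⟨ ++-cong (⊗-assoc (scalar q e) (eIdx js) (eIdx ks)) ≋-refl ⟨
  (scalar q e ⊗ eIdx js) ⊗ eIdx ks ++ ⟦ g ⟧ ⊗ eIdx ks
    ≈⟨ ⊗-distribʳ (scalar q e ⊗ eIdx js) ⟦ g ⟧ (eIdx ks) ⟨
  ⟦ (q , e , js) ∷ g ⟧ ⊗ eIdx ks
    ∎
  where open ≋-Reasoning

-- ħ b = e_1 − e_1̄
bExpansion : Combination
bExpansion = (1ℚ , ℤ.-1ℤ , pos 0 ∷ []) ∷ (ℚ.- 1ℚ , ℤ.-1ℤ , 1̄ ∷ []) ∷ []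

b≋bExpansion : b ≋ ⟦ bExpansion ⟧
b≋bExpansion = mk≋ λ F → identity (F ℤ.-1ℤ (𝐚 ∷ 𝐛 ∷ [])) (F ℤ.0ℤ (𝐛 ∷ []))
  where
  identity : ∀ x y → 1ℚ ℚ.* y ℚ.+ 0ℚ ≡ 1ℚ ℚ.* x ℚ.+ (1ℚ ℚ.* y ℚ.+ ((ℚ.- 1ℚ) ℚ.* x ℚ.+ 0ℚ))
  identity = solve 2 (λ x y → con 1ℚ :* y :+ con 0ℚ
                             := con 1ℚ :* x :+ (con 1ℚ :* y :+ (con (ℚ.- 1ℚ) :* x :+ con 0ℚ))) refl

-- a e_1̄ = e_2 − ħ e_1̄  and  a e_k = e_{k+1}
aExpansion : ℕ̂ → Combination
aExpansion 1̄ = (1ℚ , ℤ.0ℤ , pos 1 ∷ []) ∷ (ℚ.- 1ℚ , ℤ.1ℤ , 1̄ ∷ []) ∷ []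
aExpansion (pos m) = (1ℚ , ℤ.0ℤ , pos (suc m) ∷ []) ∷ []

⟦single⟧ : ∀ k → ⟦ (1ℚ , ℤ.0ℤ , k ∷ []) ∷ [] ⟧ ≋ e₁ k
⟦single⟧ k = begin
  1𝔥 ⊗ (e₁ k ⊗ 1𝔥) ++ []  ≡⟨ LP.++-identityʳ _ ⟩
  1𝔥 ⊗ (e₁ k ⊗ 1𝔥)        ≈⟨ ⊗-identityˡ (e₁ k ⊗ 1𝔥) ⟩
  e₁ k ⊗ 1𝔥               ≈⟨ ⊗-identityʳ (e₁ k) ⟩
  e₁ k                    ∎
  where open ≋-Reasoning

a⊗e₁≋aExpansion : ∀ k → a ⊗ e₁ k ≋ ⟦ aExpansion k ⟧
a⊗e₁≋aExpansion 1̄ = mk≋ λ F → identity (F ℤ.0ℤ (𝐚 ∷ 𝐚 ∷ 𝐛 ∷ [])) (F ℤ.1ℤ (𝐚 ∷ 𝐛 ∷ []))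
  where
  identity : ∀ x y → 1ℚ ℚ.* x ℚ.+ 0ℚ ≡ 1ℚ ℚ.* x ℚ.+ (1ℚ ℚ.* y ℚ.+ ((ℚ.- 1ℚ) ℚ.* y ℚ.+ 0ℚ))
  identity = solve 2 (λ x y → con 1ℚ :* x :+ con 0ℚ
                             := con 1ℚ :* x :+ (con 1ℚ :* y :+ (con (ℚ.- 1ℚ) :* y :+ con 0ℚ))) refl
a⊗e₁≋aExpansion (pos m) = begin
  a ⊗ ((a ^ m ⊗ (a ⊕ ħ)) ⊗ b)  ≈⟨ ⊗-assoc a (a ^ m ⊗ (a ⊕ ħ)) b ⟨
  (a ⊗ (a ^ m ⊗ (a ⊕ ħ))) ⊗ b  ≈⟨ ⊗-congˡ b (⊗-assoc a (a ^ m) (a ⊕ ħ)) ⟨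
  e₁ (pos (suc m))             ≈⟨ ⟦single⟧ (pos (suc m)) ⟨
  ⟦ aExpansion (pos m) ⟧        ∎
  where open ≋-Reasoning

data Headed (P : ℕ̂ → Set) : Index → Set where
  _∷_ : ∀ {k} → P k → ∀ ks → Headed P (k ∷ ks)

NonEmpty : Index → Set
NonEmpty = Headed (λ _ → ⊤)

HeadNot1 : Index → Set
HeadNot1 = Headed (λ k → ¬ k ≡ pos 0)

HeadNot1⇒NonEmpty : ∀ {ks} → HeadNot1 ks → NonEmpty ks
HeadNot1⇒NonEmpty (_ ∷ ks) = tt ∷ ks

HeadNot1⇒Admissible : ∀ {ks} → HeadNot1 ks → Admissible ks
HeadNot1⇒Admissible (k≢1 ∷ _) = k≢1

b⊗eIdx-InSpan : ∀ ks → InSpan NonEmpty (b ⊗ eIdx ks)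
b⊗eIdx-InSpan ks = bExpansion ⊙ ks , (tt ∷ ks) ∷ (tt ∷ ks) ∷ [] ,
                   ≋-trans (⟦⊙⟧ bExpansion ks) (⊗-congˡ (eIdx ks) (≋-sym b≋bExpansion))

a⊗eIdx-InSpan : ∀ {ks} → NonEmpty ks → InSpan HeadNot1 (a ⊗ eIdx ks)
a⊗eIdx-InSpan {k ∷ ks} (_ ∷ ks) = aExpansion k ⊙ ks , heads k , (begin
  ⟦ aExpansion k ⊙ ks ⟧      ≈⟨ ⟦⊙⟧ (aExpansion k) ks ⟩
  ⟦ aExpansion k ⟧ ⊗ eIdx ks ≈⟨ ⊗-congˡ (eIdx ks) (a⊗e₁≋aExpansion k) ⟨
  (a ⊗ e₁ k) ⊗ eIdx ks       ≈⟨ ⊗-assoc a (e₁ k) (eIdx ks) ⟩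
  a ⊗ eIdx (k ∷ ks)          ∎)
  where
  open ≋-Reasoning
  heads : ∀ k → All (λ t → HeadNot1 (indexOf t)) (aExpansion k ⊙ ks)
  heads 1̄ = ((λ ()) ∷ ks) ∷ ((λ ()) ∷ ks) ∷ []
  heads (pos m) = ((λ ()) ∷ ks) ∷ []

b⊗-InSpan : ∀ {P x} → InSpan P x → InSpan NonEmpty (b ⊗ x)
b⊗-InSpan = InSpan-monomial-⊗ 1ℚ ℤ.0ℤ (𝐛 ∷ []) (λ {ks} _ → b⊗eIdx-InSpan ks)

a⊗-InSpan : ∀ {x} → InSpan NonEmpty x → InSpan HeadNot1 (a ⊗ x)
a⊗-InSpan = InSpan-monomial-⊗ 1ℚ ℤ.0ℤ (𝐚 ∷ []) a⊗eIdx-InSpan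

EndsWithB-InSpan : ∀ {w} → EndsWithB w → InSpan NonEmpty (monomial 1ℚ ℤ.0ℤ w)
EndsWithB-InSpan [𝐛] = b⊗-InSpan (InSpan-1𝔥 {λ _ → ⊤} tt)
EndsWithB-InSpan (𝐛 ∷ ends) = b⊗-InSpan (EndsWithB-InSpan ends)
EndsWithB-InSpan (𝐚 ∷ ends) = InSpan-mono HeadNot1⇒NonEmpty (a⊗-InSpan (EndsWithB-InSpan ends))

ABWord-InSpan : ∀ {w} → ABWord w → InSpan Admissible (monomial 1ℚ ℤ.0ℤ w)
ABWord-InSpan (𝐚∷ _ , _ ∷ ends) = InSpan-mono HeadNot1⇒Admissible (a⊗-InSpan (EndsWithB-InSpan ends))

AllWords-InSpan : ∀ {P R} → (∀ {w} → R w → InSpan P (monomial 1ℚ ℤ.0ℤ w)) →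
                  ∀ {x} → AllWords R x → InSpan P x
AllWords-InSpan span {[]} [] = InSpan-[]
AllWords-InSpan span {(q , e , w) ∷ x} (Rw ∷ Rx) =
  InSpan-++ (InSpan-≋ (InSpan-scalar q e (span Rw)) (≡⇒≋ scaled)) (AllWords-InSpan span Rx)
  where
  scaled : scalar q e ⊗ monomial 1ℚ ℤ.0ℤ w ≡ monomial q e w
  scaled = cong₂ (λ q′ e′ → monomial q′ e′ w) (ℚP.*-identityʳ q) (ℤP.+-identityʳ e)

toAdmComb : ∀ g → All (λ t → Admissible (indexOf t)) g → AdmComb
toAdmComb [] [] = []
toAdmComb ((q , e , ks) ∷ g) (adm ∷ adms) = ((q , e) ∷ [] , ks , adm) ∷ toAdmComb g adms

evalComb-toAdmComb : ∀ g adms → evalComb (toAdmComb g adms) ≡ ⟦ g ⟧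
evalComb-toAdmComb [] [] = refl
evalComb-toAdmComb ((q , e , ks) ∷ g) (_ ∷ adms) = cong (scalar q e ⊗ eIdx ks ++_) (evalComb-toAdmComb g adms)

InSpan⇒∈𝔥⁰ : ∀ {x} → InSpan Admissible x → x ∈𝔥⁰
InSpan⇒∈𝔥⁰ (g , adms , g≋x) =
  toAdmComb g adms , ≋⇒≈ (≋-trans (≡⇒≋ (evalComb-toAdmComb g adms)) g≋x)

lemma3p12 : (n : ℕ) → .{{_ : NonZero n}} → (x : 𝔥) → x ∈𝔥⁰ → ∂ n x ∈𝔥⁰
lemma3p12 n x (c , c≈x) = InSpan⇒∈𝔥⁰ (InSpan-≋ ∂c-InSpan (∂-cong n (≈⇒≋ {evalComb c} {x} c≈x)))
  where
  ∂c-InSpan : InSpan Admissible (∂ n (evalComb c))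
  ∂c-InSpan = AllWords-InSpan ABWord-InSpan (∂-ABWord n (evalComb-𝔥⁰Word c))
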